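{- Let $(E_i,\delta_{i,j})_{i\le j\in\mathbb{N}}$ be a direct system of sets indexed by $\mathbb{N}$ with every $E_i$ countable, and for each $i$ let $u_i:\mathbb{N}\to E_i$ be surjective. Let $D_i\subset E_i\times E_i$ ($i\in\mathbb{N}$) be subsets such that for all $i\in\mathbb{N}$ $$D_{i+1}\supseteq \Delta_{i,i+1}(D_i)\cup\Bigl\{\bigl(x,\ \delta_{c_\gamma(i),i+1}(u_{c_\gamma(i)}(r_\gamma(i)))\bigr): x\in E_{i+1}\Bigr\},$$ where $\Delta_{i,j}=\delta_{i,j}\times\delta_{i,j}$. Then $(D_i,\Delta_{i,j}|_{D_i})_{i\le j}$ is a direct system and $\varinjlim D_i=\varinjlim E_i\times\varinjlim E_i$, i.e. the map $\varinjlim D_i\to\varinjlim E_i\times\varinjlim E_i$ induced by the inclusions $D_i\subset E_i\times E_i$ is a bijection.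
   Context: A direct system indexed by $\mathbb{N}$ consists of sets $E_i$ and maps $\delta_{i,j}:E_i\to E_j$ for $i\le j$ with $\delta_{i,i}=\mathrm{id}$ and $\delta_{j,k}\circ\delta_{i,j}=\delta_{i,k}$; its direct limit $\varinjlim E_i$ is the disjoint union $\bigsqcup E_i$ modulo $x_i\sim y_j$ iff $\delta_{i,k}(x_i)=\delta_{j,k}(y_j)$ for some $k\ge i,j$, with canonical maps $\delta_i:E_i\to\varinjlim E_i$. The Cantor pairing function $\gamma:\mathbb{N}\times\mathbb{N}\to\mathbb{N}$, $\gamma(i,j)=\tfrac12(i+j)(i+j+1)+i$, is a bijection; write $\gamma^{ -1}(n)=(c_\gamma(n),r_\gamma(n))$, so that $c_\gamma(n)\le n$. -}

module Defs where

open import Data.Nat using (ℕ; zero; suc; _+_; _*_; _≤_; z≤n; s≤s)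
open import Data.Nat.Properties using (≤-refl; ≤-trans; m≤n⇒m≤1+n)
open import Data.Nat.DivMod using (_/_)
open import Data.Product using (Σ; ∃; _×_; _,_; proj₁; proj₂)
open import Relation.Binary.PropositionalEquality using (_≡_)

γ : ℕ → ℕ → ℕ
γ i j = ((i + j) * suc (i + j)) / 2 + i

-- γ⁻¹, computed by enumerating the pairs in the order of γ:
-- γ(i, suc j) + 1 = γ(suc i, j)  and  γ(i, 0) + 1 = γ(0, suc i).
γ⁻¹ : ℕ → ℕ × ℕ
γ⁻¹ zero = 0 , 0
γ⁻¹ (suc n) with γ⁻¹ n
... | i , zero  = 0 , suc i
... | i , suc j = suc i , j

cγ : ℕ → ℕ
cγ n = proj₁ (γ⁻¹ n)

rγ : ℕ → ℕ
rγ n = proj₂ (γ⁻¹ n)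

cγ≤ : ∀ n → cγ n ≤ n
cγ≤ zero = z≤n
cγ≤ (suc n) with γ⁻¹ n | cγ≤ n
... | i , zero  | _ = z≤n
... | i , suc j | h = s≤s h

record DirectSystem : Set₁ where
  field
    E      : ℕ → Set
    δ      : ∀ {i j} → i ≤ j → E i → E j
    δ-id   : ∀ {i} (x : E i) → δ (≤-refl {i}) x ≡ x
    δ-comp : ∀ {i j k} (p : i ≤ j) (q : j ≤ k) (x : E i) →
             δ q (δ p x) ≡ δ (≤-trans p q) x

module _ (S : DirectSystem) where
  open DirectSystem S

  -- underlying set of the disjoint union ⊔ E_i; the direct limit is this
  -- set modulo _∼Lim_ (a setoid, since Agda has no quotient types)
  Lim : Set
  Lim = Σ ℕ E

  _∼Lim_ : Lim → Lim → Set
  (i , x) ∼Lim (j , y) =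
    ∃ λ k → Σ (i ≤ k) λ p → Σ (j ≤ k) λ q → δ p x ≡ δ q y

  _∼Lim²_ : Lim × Lim → Lim × Lim → Set
  (a , b) ∼Lim² (a' , b') = (a ∼Lim a') × (b ∼Lim b')

  Subsets : Set₁
  Subsets = (i : ℕ) → E i → E i → Set

  ΔClosed : Subsets → Set
  ΔClosed D = ∀ {i j} (p : i ≤ j) {x y : E i} →
              D i x y → D j (δ p x) (δ p y)

  LimD : Subsets → Set
  LimD D = Σ ℕ λ i → Σ (E i × E i) λ xy → D i (proj₁ xy) (proj₂ xy)

  -- direct-limit relation of the system (D_i, Δ_{i,j}|D_i): equality in D_k
  -- is equality of pairs in E_k × E_k
  _∼LimD_ : {D : Subsets} → LimD D → LimD D → Set
  (i , (x , y) , _) ∼LimD (j , (x' , y') , _) =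
    ∃ λ k → Σ (i ≤ k) λ p → Σ (j ≤ k) λ q →
      (δ p x ≡ δ q x') × (δ p y ≡ δ q y')

  φ : {D : Subsets} → LimD D → Lim × Lim
  φ (i , (x , y) , _) = (i , x) , (i , y)

module Submission where

-- Write N_n = δ_{cγ(n),n+1}(u_{cγ(n)}(rγ(n))) for the "new point"
-- that the hypothesis forces into the second coordinate of D_{n+1}.
--   * Closure under one-step maps Δ_{i,i+1} propagates, by induction on the
--     distance j - i, to closure under every Δ_{i,j}; so (D_i, Δ_{i,j}) is a
--     direct system.
--   * The map lim D → lim E × lim E is well defined by projection, and it is
--     injective because two witnesses k, k' of equality in the two factors can
--     be pushed to the common index k + k'.
--   * Surjectivity rests on the Cantor enumeration: γ⁻¹ is surjective, so every
--     point e ∈ E_J (written e = u_J(m)) is, up to δ, some new point N_n with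
--     n = γ(J,m).  A pair ([x],[y]) is then the image of (δ x, N_n) ∈ D_{n+1}.

open import Defs
open import Data.Nat using (ℕ; zero; suc; _≤_; _+_; _≤′_; ≤′-refl; ≤′-step)
open import Data.Nat.Properties
  using (m≤n⇒m≤1+n; n≤1+n; ≤-irrelevant; ≤-refl; ≤-trans; m≤m+n; m≤n+m;
         +-suc; +-identityʳ; ≤⇒≤′; ≤′⇒≤)
open import Data.Product using (Σ; ∃; _×_; _,_; proj₁; proj₂)
open import Relation.Binary.PropositionalEquality
  using (_≡_; refl; sym; trans; cong; subst; subst₂; module ≡-Reasoning)

γ⁻¹-down : ∀ n a b → γ⁻¹ n ≡ (a , suc b) → γ⁻¹ (suc n) ≡ (suc a , b)
γ⁻¹-down n a b eq rewrite eq = refl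

γ⁻¹-next : ∀ n a → γ⁻¹ n ≡ (a , 0) → γ⁻¹ (suc n) ≡ (0 , suc a)
γ⁻¹-next n a eq rewrite eq = refl

γ⁻¹-walk : ∀ c a b n → γ⁻¹ n ≡ (a , c + b) → γ⁻¹ (c + n) ≡ (c + a , b)
γ⁻¹-walk zero    a b n eq = eq
γ⁻¹-walk (suc c) a b n eq =
  γ⁻¹-down (c + n) (c + a) b
    (γ⁻¹-walk c a (suc b) n (subst (λ t → γ⁻¹ n ≡ (a , t)) (sym (+-suc c b)) eq))

-- Every pair (0 , s) is enumerated: walk down the diagonal of (0 , t) to
-- (t , 0), whose successor is (0 , t + 1).
γ⁻¹-hits-column₀ : ∀ s → ∃ λ n → γ⁻¹ n ≡ (0 , s)
γ⁻¹-hits-column₀ zero = 0 , refl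
γ⁻¹-hits-column₀ (suc t) with γ⁻¹-hits-column₀ t
... | n , eq = suc (t + n) , γ⁻¹-next (t + n) t reach-row₀
  where
  reach-row₀ : γ⁻¹ (t + n) ≡ (t , 0)
  reach-row₀ = subst (λ a → γ⁻¹ (t + n) ≡ (a , 0)) (+-identityʳ t)
    (γ⁻¹-walk t 0 0 n (subst (λ s → γ⁻¹ n ≡ (0 , s)) (sym (+-identityʳ t)) eq))

-- Every pair (c , r) is enumerated: it lies c steps down the diagonal of (0 , c + r).
γ⁻¹-surjective : ∀ c r → ∃ λ n → γ⁻¹ n ≡ (c , r)
γ⁻¹-surjective c r with γ⁻¹-hits-column₀ (c + r)
... | n , eq = c + n , subst (λ a → γ⁻¹ (c + n) ≡ (a , r)) (+-identityʳ c) (γ⁻¹-walk c 0 r n eq)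

module DirectSystemFacts (S : DirectSystem) where
  open DirectSystem S

  δ-irrelevant : ∀ {i j} (p q : i ≤ j) (x : E i) → δ p x ≡ δ q x
  δ-irrelevant p q x = cong (λ r → δ r x) (≤-irrelevant p q)

  δ-refl : ∀ {i} (p : i ≤ i) (x : E i) → δ p x ≡ x
  δ-refl p x = trans (δ-irrelevant p ≤-refl x) (δ-id x)

  δ-comp′ : ∀ {i j k} (p : i ≤ j) (q : j ≤ k) (r : i ≤ k) (x : E i) →
            δ q (δ p x) ≡ δ r x
  δ-comp′ p q r x = trans (δ-comp p q x) (δ-irrelevant _ r x)

  stepClosed⇒ΔClosed : (D : Subsets S) →
    (∀ i {x y : E i} → D i x y → D (suc i) (δ (n≤1+n i) x) (δ (n≤1+n i) y)) →
    ΔClosed S D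
  stepClosed⇒ΔClosed D step p d = go (≤⇒≤′ p) p d
    where
    go : ∀ {i j} → i ≤′ j → (p : i ≤ j) {x y : E i} → D i x y → D j (δ p x) (δ p y)
    go ≤′-refl p {x} {y} d = subst₂ (D _) (sym (δ-refl p x)) (sym (δ-refl p y)) d
    go (≤′-step {j} i≤′j) p {x} {y} d =
      subst₂ (D (suc j)) (δ-comp′ i≤j (n≤1+n j) p x) (δ-comp′ i≤j (n≤1+n j) p y)
        (step j (go i≤′j i≤j d))
      where i≤j = ≤′⇒≤ i≤′j

  raise : ∀ {i j k l} (p : i ≤ k) (q : j ≤ k) (k≤l : k ≤ l) (p′ : i ≤ l) (q′ : j ≤ l)
          {x : E i} {y : E j} → δ p x ≡ δ q y → δ p′ x ≡ δ q′ y
  raise p q k≤l p′ q′ {x} {y} eq = begin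
    δ p′ x         ≡⟨ sym (δ-comp′ p k≤l p′ x) ⟩
    δ k≤l (δ p x)  ≡⟨ cong (δ k≤l) eq ⟩
    δ k≤l (δ q y)  ≡⟨ δ-comp′ q k≤l q′ y ⟩
    δ q′ y         ∎
    where open ≡-Reasoning

  -- Equality in lim E × lim E of two images of lim D is equality in lim D:
  -- the two witnesses k, k' are both raised to k + k'.
  φ-injective : {D : Subsets S} (a b : LimD S D) →
                _∼Lim²_ S (φ S a) (φ S b) → _∼LimD_ S a b
  φ-injective _ _ ((k , p , q , eq) , (k′ , p′ , q′ , eq′)) =
    k + k′ , ≤-trans p k≤ , ≤-trans q k≤ ,
    raise p q k≤ _ _ eq , raise p′ q′ (m≤n+m k′ k) _ _ eq′
    where k≤ = m≤m+n k k′

  φ-respects : {D : Subsets S} (a b : LimD S D) →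
               _∼LimD_ S a b → _∼Lim²_ S (φ S a) (φ S b)
  φ-respects _ _ (k , p , q , eq , eq′) = (k , p , q , eq) , (k , p , q , eq′)

  module Enumeration (u : (i : ℕ) → ℕ → E i) (u-surj : ∀ i (x : E i) → ∃ λ n → u i n ≡ x) where

    newPoint : (n : ℕ) → E (suc n)
    newPoint n = δ (m≤n⇒m≤1+n (cγ≤ n)) (u (cγ n) (rγ n))

    newPoint-hits : ∀ J (e : E J) →
      ∃ λ n → Σ (J ≤ suc n) λ J≤ → newPoint n ≡ δ J≤ e
    newPoint-hits J e with u-surj J e
    ... | m , um≡e with γ⁻¹-surjective J m
    ...   | n , eq = n , J≤ , hit (cγ n) (rγ n) _ (cong proj₁ eq) (cong proj₂ eq) um≡e
      where
      J≤ : J ≤ suc n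
      J≤ = subst (λ c → c ≤ suc n) (cong proj₁ eq) (m≤n⇒m≤1+n (cγ≤ n))
      hit : ∀ c r (P : c ≤ suc n) → c ≡ J → r ≡ m → u J m ≡ e → δ P (u c r) ≡ δ J≤ e
      hit c r P refl refl refl = δ-irrelevant P J≤ _

    φ-surjective : (D : Subsets S) → (∀ n (x : E (suc n)) → D (suc n) x (newPoint n)) →
      ∀ (e : Lim S × Lim S) → ∃ λ (a : LimD S D) → _∼Lim²_ S (φ S a) e
    φ-surjective D new ((i , x) , (j , y)) with newPoint-hits (i + j) (δ (m≤n+m j i) y)
    ... | n , J≤ , hits =
      (suc n , (δ i≤ x , newPoint n) , new n (δ i≤ x)) ,
      (suc n , ≤-refl , i≤ , δ-id _) ,
      (suc n , ≤-refl , j≤ , trans (δ-id _) (trans hits (δ-comp′ (m≤n+m j i) J≤ j≤ y)))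
      where
      i≤ = ≤-trans (m≤m+n i j) J≤
      j≤ = ≤-trans (m≤n+m j i) J≤

lemma1 : (S : DirectSystem) →
    let open DirectSystem S in
    (u : (i : ℕ) → ℕ → E i) →
    (∀ i (x : E i) → ∃ λ n → u i n ≡ x) →
    (D : Subsets S) →
    (∀ i {x y : E i} → D i x y → D (suc i) (δ (n≤1+n i) x) (δ (n≤1+n i) y)) →
    (∀ i (x : E (suc i)) →
    D (suc i) x (δ (m≤n⇒m≤1+n (cγ≤ i)) (u (cγ i) (rγ i)))) →
    Σ (ΔClosed S D) λ _ →
    (∀ (a b : LimD S D) → _∼LimD_ S a b → _∼Lim²_ S (φ S a) (φ S b)) ×
    (∀ (a b : LimD S D) → _∼Lim²_ S (φ S a) (φ S b) → _∼LimD_ S a b) ×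
    (∀ (e : Lim S × Lim S) → ∃ λ (a : LimD S D) → _∼Lim²_ S (φ S a) e)
lemma1 S u u-surj D step new =
  stepClosed⇒ΔClosed D step , φ-respects , φ-injective , φ-surjective D new
  where
  open DirectSystemFacts S
  open Enumeration u u-surj
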